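{- Let $g$ be as defined in the context. Then: (1) $g(N,1)=0$ for all $N\ge 1$; (2) if $N\ge \Delta \geq 2$ and $N-1 \equiv k \pmod{\Delta-1}$ with $0 \leq k \leq \Delta-2$, then \[g(N,\Delta)=\frac{(N-k-1)\Delta}{2}+\binom{k+1}{2}\leq \frac{(N-1)\Delta}{2};\] (3) $g(N+1,\Delta)\geq g(N,\Delta)+1$ for $N\ge\Delta \geq 2$; (4) $g(N,\Delta+1)\geq g(N,\Delta)+1$ for $N>\Delta\ge 1$.
   Context: All graphs are finite and simple; $L(G)$ is the line graph, so $e(L(G))=\sum_v\binom{\deg(v)}{2}$. For integers $N\ge\Delta\ge1$, $g(N,\Delta)=\max\{e(L(F)) : F \text{ acyclic},\ e(F)=N,\ \Delta(F)=\Delta,\ \delta(F)\geq 1\}$. -}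

module Defs where

open import Data.Nat using (ℕ; zero; suc; _+_; _*_; _≤_; _<_; _<ᵇ_)
open import Data.Nat.Combinatorics using (_C_)
open import Data.Bool using (Bool; true; false; _∧_; if_then_else_)
open import Data.Fin using (Fin; toℕ)
open import Data.List using (List; []; _∷_; length; map; allFin)
open import Data.Nat.ListAction using (sum)
open import Data.Unit using (⊤)
open import Data.List.Relation.Unary.Unique.Propositional using (Unique)
open import Data.Product using (Σ; _×_; ∃)
open import Relation.Binary.PropositionalEquality using (_≡_)
open import Data.Empty using (⊥)
open import Relation.Nullary using (¬_)

record Graph : Set where
  field
    n      : ℕ
    adj    : Fin n → Fin n → Bool
    sym    : ∀ u v → adj u v ≡ adj v u
    irrefl : ∀ v → adj v v ≡ false
open Graph public

Adj : (G : Graph) → Fin (n G) → Fin (n G) → Set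
Adj G u v = adj G u v ≡ true

b2n : Bool → ℕ
b2n true  = 1
b2n false = 0

deg : (G : Graph) → Fin (n G) → ℕ
deg G v = sum (map (λ u → b2n (adj G v u)) (allFin (n G)))

edges : Graph → ℕ
edges G = sum (map (λ u → sum (map (λ v → b2n ((toℕ u <ᵇ toℕ v) ∧ adj G u v))
                                   (allFin (n G))))
                   (allFin (n G)))

-- e(L(G)) = Σ_v binom(deg v, 2)
lineEdges : Graph → ℕ
lineEdges G = sum (map (λ v → deg G v C 2) (allFin (n G)))

Walk : (G : Graph) → List (Fin (n G)) → Set
Walk G []           = ⊤
Walk G (x ∷ [])     = ⊤
Walk G (x ∷ y ∷ xs) = Adj G x y × Walk G (y ∷ xs)

lastOf : {A : Set} → A → List A → A
lastOf a []       = a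
lastOf a (x ∷ xs) = lastOf x xs

IsCycle : (G : Graph) → List (Fin (n G)) → Set
IsCycle G []       = ⊥
IsCycle G (v ∷ vs) = 3 ≤ length (v ∷ vs) × Unique (v ∷ vs) × Walk G (v ∷ vs)
                     × Adj G (lastOf v vs) v

Acyclic : Graph → Set
Acyclic G = ∀ (c : List (Fin (n G))) → ¬ IsCycle G c

MaxDegIs : Graph → ℕ → Set
MaxDegIs G Δ = (∀ v → deg G v ≤ Δ) × ∃ (λ v → deg G v ≡ Δ)

MinDegPos : Graph → Set
MinDegPos G = ∀ v → 1 ≤ deg G v

Admissible : ℕ → ℕ → Graph → Set
Admissible N Δ F = Acyclic F × edges F ≡ N × MaxDegIs F Δ × MinDegPos F

-- IsG N Δ m  :⇔  g(N,Δ) = m, i.e. m is the maximum (attained) of e(L(F))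
-- over admissible F
IsG : ℕ → ℕ → ℕ → Set
IsG N Δ m = (Σ Graph λ F → Admissible N Δ F × lineEdges F ≡ m)
          × (∀ F → Admissible N Δ F → lineEdges F ≤ m)

{-# OPTIONS --safe #-}
module Submission where

-- Write every degree of an admissible forest F as 1 + x_v.  Since a forest on |V| vertices has
-- at most |V| − 1 edges, Σ x_v = 2N − |V| ≤ N − 1, while 0 ≤ x_v ≤ Δ − 1 and
-- 2 e(L(F)) = Σ x_v (x_v + 1).  The convex function x (x + 1) is maximised under these
-- constraints by q parts equal to Δ − 1 and one part k, where N − 1 = q (Δ − 1) + k; this
-- gives g(N, Δ) ≤ q C(Δ, 2) + C(k + 1, 2), and a caterpillar with q spine vertices of
-- degree Δ followed by one of degree k + 1 attains the bound.  For Δ = 1 the forest is a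
-- matching.  The monotonicity statements compare the closed forms through the same
-- maximality: an excess sequence for the smaller parameters, improved by 2, is still
-- admissible for the larger ones.

open import Data.Nat hiding (_≟_)
open import Data.Nat.Properties hiding (_≟_)
open import Data.Nat.ListAction using (sum)
open import Data.Nat.DivMod using (_/_; _%_; m≡m%n+[m/n]*n; m%n<n; m*n/n≡m)
open import Data.Nat.Combinatorics using (_C_; nCk+nC[k+1]≡[n+1]C[k+1]; nC1≡n)
open import Data.Nat.Tactic.RingSolver using (solve-∀)
open import Data.Fin using (Fin; zero; suc; toℕ; punchIn)
open import Data.Fin.Properties using (_≟_; toℕ-injective; toℕ<n; punchInᵢ≢i; punchIn-injective)
import Data.Fin.Properties as Fin
open import Data.Maybe using (Maybe; just; nothing; is-just)
open import Data.Bool using (Bool; true; false; _∧_; _∨_; not)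
import Data.Bool.Properties as Bool
open import Data.List using (List; []; _∷_; map; _++_; [_]; _∷ʳ_; length; tabulate; allFin; replicate)
open import Data.List.Properties
  using (map-tabulate; map-replicate; length-map; ++-assoc; ++-identityʳ; length-++-comm; length-++-sucʳ)
open import Data.List.Relation.Unary.All using (All; []; _∷_) renaming (lookup to All-lookup)
import Data.List.Relation.Unary.All.Properties as All
open import Data.List.Relation.Unary.All.Properties using (¬Any⇒All¬; tabulate⁺; replicate⁺)
open import Data.List.Relation.Unary.AllPairs using ([]; _∷_)
open import Data.List.Relation.Unary.Any using (here; there; any?)
open import Data.List.Relation.Unary.Unique.Propositional using (Unique)
import Data.List.Relation.Unary.Unique.Propositional.Properties as Unique
open import Data.List.Membership.Propositional using (_∈_; _∉_)
open import Data.List.Membership.Propositional.Properties using (∈-∃++)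
open import Data.Product using (Σ; ∃; ∃₂; _×_; _,_; proj₁; proj₂; map₂)
open import Data.Unit using (tt)
open import Function using (_∘_; id)
open import Relation.Nullary using (¬_; Dec; does; yes; no; contradiction; _×-dec_; ¬?)
open import Relation.Nullary.Reflects using (ofʸ; ofⁿ)
open import Relation.Binary.PropositionalEquality
  using (_≡_; _≢_; refl; trans; cong; cong₂; subst; module ≡-Reasoning) renaming (sym to ≡-sym)
open import Algebra.Definitions.RawMagma using (_,_)
open import Algebra.Properties.CommutativeSemigroup +-commutativeSemigroup using (x∙yz≈y∙xz)
open import Algebra.Properties.Semiring.Sum +-*-semiring
  using (sum-syntax; sum-remove; sum-cong-≗; sum-replicate-zero; ∑-distrib-+; ∑-comm; *-distribˡ-sum)
open import Defs

-- Pronic numbers and the extremal value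

[1+n]C2≡n+nC2 : ∀ n → suc n C 2 ≡ n + n C 2
[1+n]C2≡n+nC2 n = trans (≡-sym (nCk+nC[k+1]≡[n+1]C[k+1] n 1)) (cong (_+ n C 2) (nC1≡n n))

pronic : ℕ → ℕ
pronic n = n * suc n

2*[1+n]C2≡pronic : ∀ n → 2 * (suc n C 2) ≡ pronic n
2*[1+n]C2≡pronic zero    = refl
2*[1+n]C2≡pronic (suc n) = begin
  2 * (suc (suc n) C 2)        ≡⟨ cong (2 *_) ([1+n]C2≡n+nC2 (suc n)) ⟩
  2 * (suc n + suc n C 2)      ≡⟨ *-distribˡ-+ 2 (suc n) (suc n C 2) ⟩
  2 * suc n + 2 * (suc n C 2)  ≡⟨ cong (2 * suc n +_) (2*[1+n]C2≡pronic n) ⟩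
  2 * suc n + pronic n         ≡⟨ identity n ⟩
  pronic (suc n)               ∎
  where
  open ≡-Reasoning
  identity : ∀ n → 2 * suc n + n * suc n ≡ suc n * suc (suc n)
  identity = solve-∀

pronic-superadditive : ∀ x y → pronic x + pronic y ≤ pronic (x + y)
pronic-superadditive x y = begin
  pronic x + pronic y               ≤⟨ m≤m+n _ (2 * x * y) ⟩
  pronic x + pronic y + 2 * x * y   ≡⟨ identity x y ⟩
  pronic (x + y)                    ∎
  where
  open ≤-Reasoning
  identity : ∀ x y → x * suc x + y * suc y + 2 * x * y ≡ (x + y) * suc (x + y)
  identity = solve-∀

pronic-exchange : ∀ {k x} b → k ≤ x → pronic x + pronic (k + b) ≤ pronic (x + b) + pronic k
pronic-exchange {k} b k≤x with ≤⇒≤″ k≤x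
... | a , refl = begin
  pronic (k + a) + pronic (k + b)               ≤⟨ m≤m+n _ (2 * a * b) ⟩
  pronic (k + a) + pronic (k + b) + 2 * a * b   ≡⟨ identity k a b ⟩
  pronic (k + a + b) + pronic k                 ∎
  where
  open ≤-Reasoning
  identity : ∀ k a b → (k + a) * suc (k + a) + (k + b) * suc (k + b) + 2 * a * b
                  ≡ (k + a + b) * suc (k + a + b) + k * suc k
  identity = solve-∀

pronic-transfer : ∀ {y D} → y < D → pronic D + pronic (suc y) + 2 ≤ pronic (suc D) + pronic y
pronic-transfer {y} y<D with ≤⇒≤″ y<D
... | a , refl = begin
  pronic (suc y + a) + pronic (suc y) + 2               ≤⟨ m≤m+n _ (2 * a) ⟩
  pronic (suc y + a) + pronic (suc y) + 2 + 2 * a       ≡⟨ identity y a ⟩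
  pronic (suc (suc y + a)) + pronic y                   ∎
  where
  open ≤-Reasoning
  identity : ∀ y a → (suc y + a) * suc (suc y + a) + suc y * suc (suc y) + 2 + 2 * a
                ≡ suc (suc y + a) * suc (suc (suc y + a)) + y * suc y
  identity = solve-∀

-- Smoothing by convexity: each part is either merged into the remainder k or exchanged
-- against a full part D.
pronicSum-≤ : ∀ {D} q k xs → All (_≤ D) xs → k < D → sum xs ≤ q * D + k →
              sum (map pronic xs) ≤ q * pronic D + pronic k
pronicSum-≤ q k [] [] k<D sum≤ = z≤n
pronicSum-≤ {D} q k (x ∷ xs) (x≤D ∷ xs≤D) k<D sum≤ with x ≤? k
... | yes x≤k with ≤⇒≤″ x≤k
...   | c , refl = begin
  pronic x + sum (map pronic xs)      ≤⟨ +-monoʳ-≤ (pronic x) (pronicSum-≤ q c xs xs≤D c<D rest) ⟩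
  pronic x + (q * pronic D + pronic c) ≡⟨ x∙yz≈y∙xz (pronic x) (q * pronic D) (pronic c) ⟩
  q * pronic D + (pronic x + pronic c) ≤⟨ +-monoʳ-≤ (q * pronic D) (pronic-superadditive x c) ⟩
  q * pronic D + pronic (x + c)        ∎
  where
  open ≤-Reasoning
  c<D = ≤-trans (s≤s (m≤n+m c x)) k<D
  rest : sum xs ≤ q * D + c
  rest = +-cancelˡ-≤ x _ _ (≤-trans sum≤ (≤-reflexive (x∙yz≈y∙xz (q * D) x c)))
pronicSum-≤ {D} q k (x ∷ xs) (x≤D ∷ xs≤D) k<D sum≤ | no x≰k with q | ≤⇒≤″ x≤D
... | zero  | _ = contradiction (≤-trans (m≤m+n x (sum xs)) sum≤) x≰k
... | suc q′ | b , refl = begin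
  pronic x + sum (map pronic xs)                 ≤⟨ +-monoʳ-≤ (pronic x) (pronicSum-≤ q′ (k + b) xs xs≤D kb<D rest) ⟩
  pronic x + (q′ * pronic D + pronic (k + b))    ≡⟨ x∙yz≈y∙xz (pronic x) (q′ * pronic D) (pronic (k + b)) ⟩
  q′ * pronic D + (pronic x + pronic (k + b))    ≤⟨ +-monoʳ-≤ (q′ * pronic D) (pronic-exchange b (<⇒≤ k<x)) ⟩
  q′ * pronic D + (pronic D + pronic k)          ≡⟨ identity (q′ * pronic D) (pronic D) (pronic k) ⟩
  suc q′ * pronic D + pronic k                   ∎
  where
  open ≤-Reasoning
  k<x = ≰⇒> x≰k
  kb<D : k + b < x + b
  kb<D = +-monoˡ-< b k<x
  rest : sum xs ≤ q′ * D + (k + b)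
  rest = +-cancelˡ-≤ x _ _ (≤-trans sum≤ (≤-reflexive (identity′ x b (q′ * D) k)))
    where
    identity′ : ∀ x b c k → x + b + c + k ≡ x + (c + (k + b))
    identity′ = solve-∀
  identity : ∀ a b c → a + (b + c) ≡ b + a + c
  identity = solve-∀

-- The value of g(N, D + 1) when N − 1 = q D + k with k < D.
extremalValue : (D q k : ℕ) → ℕ
extremalValue D q k = q * (suc D C 2) + suc k C 2

2*extremalValue : ∀ D q k → 2 * extremalValue D q k ≡ q * pronic D + pronic k
2*extremalValue D q k = begin
  2 * (q * (suc D C 2) + suc k C 2)       ≡⟨ identity q (suc D C 2) (suc k C 2) ⟩
  q * (2 * (suc D C 2)) + 2 * (suc k C 2) ≡⟨ cong₂ (λ a b → q * a + b) (2*[1+n]C2≡pronic D) (2*[1+n]C2≡pronic k) ⟩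
  q * pronic D + pronic k                 ∎
  where
  open ≡-Reasoning
  identity : ∀ q a b → 2 * (q * a + b) ≡ q * (2 * a) + 2 * b
  identity = solve-∀

extremalValue-maximal : ∀ {D} q k xs → All (_≤ D) xs → k < D → sum xs ≤ q * D + k →
                        sum (map pronic xs) ≤ 2 * extremalValue D q k
extremalValue-maximal {D} q k xs xs≤D k<D sum≤ =
  ≤-trans (pronicSum-≤ q k xs xs≤D k<D sum≤) (≤-reflexive (≡-sym (2*extremalValue D q k)))

extremalValue-closedForm : ∀ N {D} q k → N ∸ 1 ≡ q * D + k →
                           extremalValue D q k ≡ ((N ∸ k ∸ 1) * suc D) / 2 + suc k C 2
extremalValue-closedForm N {D} q k N∸1≡ = cong (_+ suc k C 2) (≡-sym (begin
  ((N ∸ k ∸ 1) * suc D) / 2       ≡⟨ cong (λ x → (x * suc D) / 2) N∸k∸1≡ ⟩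
  (q * D * suc D) / 2             ≡⟨ cong (_/ 2) (regroup q D (suc D C 2) (2*[1+n]C2≡pronic D)) ⟩
  (q * (suc D C 2) * 2) / 2       ≡⟨ m*n/n≡m (q * (suc D C 2)) 2 ⟩
  q * (suc D C 2)                 ∎))
  where
  open ≡-Reasoning
  N∸k∸1≡ : N ∸ k ∸ 1 ≡ q * D
  N∸k∸1≡ = begin
    N ∸ k ∸ 1       ≡⟨ ∸-+-assoc N k 1 ⟩
    N ∸ (k + 1)     ≡⟨ cong (N ∸_) (+-comm k 1) ⟩
    N ∸ (1 + k)     ≡⟨ ∸-+-assoc N 1 k ⟨
    N ∸ 1 ∸ k       ≡⟨ cong (_∸ k) N∸1≡ ⟩
    q * D + k ∸ k   ≡⟨ m+n∸n≡m (q * D) k ⟩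
    q * D           ∎
  regroup : ∀ q D c → 2 * c ≡ D * suc D → q * D * suc D ≡ q * c * 2
  regroup q D c 2c≡ = begin
    q * D * suc D   ≡⟨ *-assoc q D (suc D) ⟩
    q * (D * suc D) ≡⟨ cong (q *_) 2c≡ ⟨
    q * (2 * c)     ≡⟨ cong (q *_) (*-comm 2 c) ⟩
    q * (c * 2)     ≡⟨ *-assoc q c 2 ⟨
    q * c * 2       ∎

2*extremalValue≤ : ∀ {D} q k → k < D → 2 * extremalValue D q k ≤ (q * D + k) * suc D
2*extremalValue≤ {D} q k k<D = begin
  2 * extremalValue D q k            ≡⟨ 2*extremalValue D q k ⟩
  q * pronic D + k * suc k           ≤⟨ +-monoʳ-≤ (q * pronic D) (*-monoʳ-≤ k (<⇒≤ (s≤s k<D))) ⟩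
  q * (D * suc D) + k * suc D        ≡⟨ identity q D k ⟩
  (q * D + k) * suc D                ∎
  where
  open ≤-Reasoning
  identity : ∀ q D k → q * (D * suc D) + k * suc D ≡ (q * D + k) * suc D
  identity = solve-∀

euclideanDivision : ∀ M D → 1 ≤ D → ∃₂ λ q k → M ≡ q * D + k × k < D
euclideanDivision M (suc D) _ =
  M / suc D , M % suc D , trans (m≡m%n+[m/n]*n M (suc D)) (+-comm (M % suc D) _) , m%n<n M (suc D)

extremalValue-+1 : ∀ {D D′} q k q′ k′ xs → All (_≤ D′) xs → k′ < D′ → sum xs ≤ q′ * D′ + k′ →
                   2 * extremalValue D q k + 2 ≤ sum (map pronic xs) →
                   extremalValue D q k + 1 ≤ extremalValue D′ q′ k′
extremalValue-+1 {D} {D′} q k q′ k′ xs xs≤ k′<D′ sum≤ beats = *-cancelˡ-≤ 2 (begin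
  2 * (extremalValue D q k + 1)        ≡⟨ *-distribˡ-+ 2 (extremalValue D q k) 1 ⟩
  2 * extremalValue D q k + 2          ≤⟨ beats ⟩
  sum (map pronic xs)                  ≤⟨ extremalValue-maximal q′ k′ xs xs≤ k′<D′ sum≤ ⟩
  2 * extremalValue D′ q′ k′           ∎)
  where open ≤-Reasoning

sum-replicate : ∀ r x → sum (replicate r x) ≡ r * x
sum-replicate zero    x = refl
sum-replicate (suc r) x = cong (x +_) (sum-replicate r x)

pronicSum-replicate : ∀ r x → sum (map pronic (replicate r x)) ≡ r * pronic x
pronicSum-replicate r x = trans (cong sum (map-replicate pronic r x)) (sum-replicate r (pronic x))

-- Raising one full part D to D + 1 and lowering a part y + 1 ≤ D to y gains at least 2.
transfer : ∀ {D M P} y r → y < D → M ≡ D + suc y + r * D → P ≡ pronic D + pronic (suc y) + r * pronic D →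
           Σ (List ℕ) λ ys → All (_≤ suc D) ys × sum ys ≡ M × P + 2 ≤ sum (map pronic ys)
transfer {D} y r y<D refl refl =
  suc D ∷ y ∷ replicate r D ,
  (≤-refl ∷ ≤-trans (<⇒≤ y<D) (n≤1+n D) ∷ replicate⁺ r (n≤1+n D)) ,
  trans (cong (λ s → suc D + (y + s)) (sum-replicate r D)) (identity D y (r * D)) ,
  (begin
    pronic D + pronic (suc y) + r * pronic D + 2         ≡⟨ identity′ (pronic D + pronic (suc y)) (r * pronic D) ⟩
    pronic D + pronic (suc y) + 2 + r * pronic D         ≤⟨ +-monoˡ-≤ (r * pronic D) (pronic-transfer y<D) ⟩
    pronic (suc D) + pronic y + r * pronic D             ≡⟨ +-assoc (pronic (suc D)) (pronic y) (r * pronic D) ⟩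
    pronic (suc D) + (pronic y + r * pronic D)           ≡⟨ cong (λ s → pronic (suc D) + (pronic y + s)) (pronicSum-replicate r D) ⟨
    sum (map pronic (suc D ∷ y ∷ replicate r D))         ∎)
  where
  open ≤-Reasoning
  identity : ∀ D y e → suc D + (y + e) ≡ D + suc y + e
  identity = solve-∀
  identity′ : ∀ a b → a + b + 2 ≡ a + 2 + b
  identity′ = solve-∀

transferWitness : ∀ {D q k} → k < D → suc D ≤ q * D + k →
                  Σ (List ℕ) λ ys → All (_≤ suc D) ys × sum ys ≡ q * D + k
                                  × q * pronic D + pronic k + 2 ≤ sum (map pronic ys)
transferWitness {D}     {zero}        {zero}  k<D ()
transferWitness {D}     {suc zero}    {zero}  k<D D<D =
  contradiction (≤-trans D<D (≤-reflexive (trans (+-identityʳ _) (+-identityʳ D)))) (n≮n D)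
transferWitness {suc y} {suc (suc r)} {zero}  k<D _ = transfer y r ≤-refl (identity r y) (identity′ r y)
  where
  identity : ∀ r y → suc (suc r) * suc y + 0 ≡ suc y + suc y + r * suc y
  identity = solve-∀
  identity′ : ∀ r y → suc (suc r) * (suc y * suc (suc y)) + 0
                 ≡ suc y * suc (suc y) + suc y * suc (suc y) + r * (suc y * suc (suc y))
  identity′ = solve-∀
transferWitness {D}     {zero}        {suc y} k<D D<k = contradiction (<-trans D<k k<D) (n≮n D)
transferWitness {D}     {suc r}       {suc y} k<D _ =
  transfer y r (<-trans (n<1+n y) k<D) (identity r D y) (identity′ r (pronic D) y)
  where
  identity : ∀ r D y → suc r * D + suc y ≡ D + suc y + r * D
  identity = solve-∀
  identity′ : ∀ r p y → suc r * p + suc y * suc (suc y) ≡ p + suc y * suc (suc y) + r * p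
  identity′ = solve-∀

sum-tabulate : ∀ {n} (f : Fin n → ℕ) → sum (tabulate f) ≡ ∑[ i < n ] f i
sum-tabulate {zero}  f = refl
sum-tabulate {suc n} f = cong (f zero +_) (sum-tabulate (f ∘ suc))

sum-map-allFin : ∀ n (f : Fin n → ℕ) → sum (map f (allFin n)) ≡ ∑[ i < n ] f i
sum-map-allFin n f = trans (cong sum (map-tabulate id f)) (sum-tabulate f)

∑-mono-≤ : ∀ {n} {f g : Fin n → ℕ} → (∀ i → f i ≤ g i) → ∑[ i < n ] f i ≤ ∑[ i < n ] g i
∑-mono-≤ {zero}  f≤g = z≤n
∑-mono-≤ {suc n} f≤g = +-mono-≤ (f≤g zero) (∑-mono-≤ (f≤g ∘ suc))

∑-mono-< : ∀ {n} {f g : Fin n → ℕ} (v : Fin n) → (∀ i → f i ≤ g i) → f v < g v →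
           ∑[ i < n ] f i < ∑[ i < n ] g i
∑-mono-< zero    f≤g fv<gv = +-mono-<-≤ fv<gv (∑-mono-≤ (f≤g ∘ suc))
∑-mono-< (suc v) f≤g fv<gv = +-mono-≤-< (f≤g zero) (∑-mono-< v (f≤g ∘ suc) fv<gv)

∑-const : ∀ n c → ∑[ i < n ] c ≡ n * c
∑-const zero    c = refl
∑-const (suc n) c = cong (c +_) (∑-const n c)

indicator : ∀ {n} → Fin n → Fin n → ℕ
indicator a u = b2n (does (u ≟ a))

indicator-self : ∀ {n} (a : Fin n) → indicator a a ≡ 1
indicator-self a with a ≟ a
... | yes _   = refl
... | no a≢a = contradiction refl a≢a

indicator-punchIn : ∀ {n} (a : Fin (suc n)) j → indicator a (punchIn a j) ≡ 0
indicator-punchIn a j with punchIn a j ≟ a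
... | yes p = contradiction p (punchInᵢ≢i a j)
... | no _  = refl

∑-indicator-* : ∀ {n} (a : Fin n) (f : Fin n → ℕ) → ∑[ u < n ] (indicator a u * f u) ≡ f a
∑-indicator-* {suc n} a f = begin
  ∑[ u < suc n ] (indicator a u * f u)                                ≡⟨ sum-remove {i = a} (λ u → indicator a u * f u) ⟩
  indicator a a * f a + ∑[ j < n ] (indicator a (punchIn a j) * f (punchIn a j))
    ≡⟨ cong₂ _+_ (cong (_* f a) (indicator-self a)) (sum-cong-≗ (λ j → cong (_* f (punchIn a j)) (indicator-punchIn a j))) ⟩
  1 * f a + ∑[ j < n ] 0                                             ≡⟨ cong₂ _+_ (*-identityˡ (f a)) (sum-replicate-zero n) ⟩
  f a + 0                                                            ≡⟨ +-identityʳ (f a) ⟩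
  f a                                                                ∎
  where open ≡-Reasoning

∑-indicator : ∀ {n} (a : Fin n) → ∑[ u < n ] indicator a u ≡ 1
∑-indicator a = trans (sum-cong-≗ (λ u → ≡-sym (*-identityʳ (indicator a u)))) (∑-indicator-* a (λ _ → 1))

-- Degrees, edges and adding a vertex

deg-∑ : ∀ G v → deg G v ≡ ∑[ u < n G ] b2n (adj G v u)
deg-∑ G v = sum-map-allFin (n G) _

degreeSum : Graph → ℕ
degreeSum G = ∑[ v < n G ] deg G v

edge : (G : Graph) → Fin (n G) → Fin (n G) → ℕ
edge G u v = b2n ((toℕ u <ᵇ toℕ v) ∧ adj G u v)

edges-∑ : ∀ G → edges G ≡ ∑[ u < n G ] ∑[ v < n G ] edge G u v
edges-∑ G = trans (sum-map-allFin (n G) _) (sum-cong-≗ (λ u → sum-map-allFin (n G) (edge G u)))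

adjacency≡edge+edge : ∀ G u v → b2n (adj G u v) ≡ edge G u v + edge G v u
adjacency≡edge+edge G u v
  with toℕ u <ᵇ toℕ v | <ᵇ-reflects-< (toℕ u) (toℕ v) | toℕ v <ᵇ toℕ u | <ᵇ-reflects-< (toℕ v) (toℕ u)
... | true  | ofʸ u<v  | true  | ofʸ v<u  = contradiction v<u (<⇒≯ u<v)
... | true  | _        | false | _        = ≡-sym (+-identityʳ _)
... | false | _        | true  | _        = cong b2n (sym G u v)
... | false | ofⁿ u≮v  | false | ofⁿ v≮u
  with toℕ-injective (≤-antisym (≮⇒≥ v≮u) (≮⇒≥ u≮v))
...   | refl = cong b2n (irrefl G u)

handshake : ∀ G → degreeSum G ≡ 2 * edges G
handshake G = begin
  ∑[ u < m ] deg G u                                ≡⟨ sum-cong-≗ (deg-∑ G) ⟩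
  ∑[ u < m ] ∑[ v < m ] b2n (adj G u v)             ≡⟨ sum-cong-≗ (λ u → sum-cong-≗ (adjacency≡edge+edge G u)) ⟩
  ∑[ u < m ] ∑[ v < m ] (e u v + e v u)             ≡⟨ sum-cong-≗ (λ u → ∑-distrib-+ (e u) (λ v → e v u)) ⟩
  ∑[ u < m ] (∑[ v < m ] e u v + ∑[ v < m ] e v u)  ≡⟨ ∑-distrib-+ (λ u → ∑[ v < m ] e u v) (λ u → ∑[ v < m ] e v u) ⟩
  E + ∑[ u < m ] ∑[ v < m ] e v u                   ≡⟨ cong (E +_) (∑-comm (λ u v → e v u)) ⟩
  E + E                                             ≡⟨ cong₂ _+_ (≡-sym (edges-∑ G)) (≡-sym (edges-∑ G)) ⟩
  edges G + edges G                                 ≡⟨ cong (edges G +_) (+-identityʳ (edges G)) ⟨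
  2 * edges G                                       ∎
  where
  open ≡-Reasoning
  m = n G
  e = edge G
  E = ∑[ u < m ] ∑[ v < m ] e u v

induced : (G : Graph) {m : ℕ} → (Fin m → Fin (n G)) → Graph
induced G {m} f = record
  { n      = m
  ; adj    = λ x y → adj G (f x) (f y)
  ; sym    = λ x y → sym G (f x) (f y)
  ; irrefl = λ x → irrefl G (f x)
  }

-- The hypothesis says that f enumerates the vertices other than v.
degreeSum-induced : ∀ G v {k} (f : Fin k → Fin (n G)) →
                    (∀ g → ∑[ u < n G ] g u ≡ g v + ∑[ j < k ] g (f j)) →
                    degreeSum G ≡ deg G v + deg G v + degreeSum (induced G f)
degreeSum-induced G v {k} f split = begin
  ∑[ u < n G ] deg G u                                     ≡⟨ split (deg G) ⟩
  deg G v + ∑[ j < k ] deg G (f j)                         ≡⟨ cong (deg G v +_) (sum-cong-≗ deg-f) ⟩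
  deg G v + ∑[ j < k ] (b2n (adj G v (f j)) + deg H j)     ≡⟨ cong (deg G v +_) (∑-distrib-+ (λ j → b2n (adj G v (f j))) (deg H)) ⟩
  deg G v + (∑[ j < k ] b2n (adj G v (f j)) + degreeSum H) ≡⟨ cong (λ d → deg G v + (d + degreeSum H)) (≡-sym deg-v) ⟩
  deg G v + (deg G v + degreeSum H)                        ≡⟨ ≡-sym (+-assoc (deg G v) _ _) ⟩
  deg G v + deg G v + degreeSum H                          ∎
  where
  open ≡-Reasoning
  H = induced G f
  deg-v : deg G v ≡ ∑[ j < k ] b2n (adj G v (f j))
  deg-v = trans (deg-∑ G v) (trans (split _) (cong (λ b → b2n b + ∑[ j < k ] b2n (adj G v (f j))) (irrefl G v)))
  deg-f : ∀ j → deg G (f j) ≡ b2n (adj G v (f j)) + deg H j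
  deg-f j = trans (deg-∑ G (f j))
            (trans (split _) (cong₂ _+_ (cong b2n (sym G (f j) v)) (≡-sym (deg-∑ H j))))

neighbourOf : ∀ {m} → Maybe (Fin m) → Fin m → Bool
neighbourOf nothing  v = false
neighbourOf (just a) v = does (v ≟ a)

addVertex : (G : Graph) → Maybe (Fin (n G)) → Graph
addVertex G mb = record { n = suc (n G) ; adj = adj′ ; sym = sym′ ; irrefl = irrefl′ }
  where
  adj′ : Fin (suc (n G)) → Fin (suc (n G)) → Bool
  adj′ zero    zero    = false
  adj′ zero    (suc v) = neighbourOf mb v
  adj′ (suc u) zero    = neighbourOf mb u
  adj′ (suc u) (suc v) = adj G u v
  sym′ : ∀ u v → adj′ u v ≡ adj′ v u
  sym′ zero    zero    = refl
  sym′ zero    (suc v) = refl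
  sym′ (suc u) zero    = refl
  sym′ (suc u) (suc v) = sym G u v
  irrefl′ : ∀ v → adj′ v v ≡ false
  irrefl′ zero    = refl
  irrefl′ (suc v) = irrefl G v

∑-neighbourOf : ∀ {m} (mb : Maybe (Fin m)) → ∑[ v < m ] b2n (neighbourOf mb v) ≡ b2n (is-just mb)
∑-neighbourOf {m} nothing = sum-replicate-zero m
∑-neighbourOf (just a)    = ∑-indicator a

module _ (G : Graph) (mb : Maybe (Fin (n G))) where

  deg-addVertex-new : deg (addVertex G mb) zero ≡ b2n (is-just mb)
  deg-addVertex-new = trans (deg-∑ (addVertex G mb) zero) (∑-neighbourOf mb)

  deg-addVertex-old : ∀ u → deg (addVertex G mb) (suc u) ≡ b2n (neighbourOf mb u) + deg G u
  deg-addVertex-old u = trans (deg-∑ (addVertex G mb) (suc u)) (cong (b2n (neighbourOf mb u) +_) (≡-sym (deg-∑ G u)))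

  edges-addVertex : edges (addVertex G mb) ≡ b2n (is-just mb) + edges G
  edges-addVertex = trans (edges-∑ (addVertex G mb)) (cong₂ _+_ (∑-neighbourOf mb) (≡-sym (edges-∑ G)))

lineEdges-addLeaf : ∀ G a → lineEdges (addVertex G (just a)) ≡ lineEdges G + deg G a
lineEdges-addLeaf G a = begin
  lineEdges G′                                            ≡⟨ sum-map-allFin (suc (n G)) _ ⟩
  deg G′ zero C 2 + ∑[ u < n G ] (deg G′ (suc u) C 2)     ≡⟨ cong₂ _+_ (cong (_C 2) (deg-addVertex-new G (just a)))
                                                                       (sum-cong-≗ old) ⟩
  0 + ∑[ u < n G ] (deg G u C 2 + indicator a u * deg G u) ≡⟨ ∑-distrib-+ (λ u → deg G u C 2) (λ u → indicator a u * deg G u) ⟩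
  ∑[ u < n G ] (deg G u C 2) + ∑[ u < n G ] (indicator a u * deg G u)
                                                          ≡⟨ cong₂ _+_ (≡-sym (sum-map-allFin (n G) _)) (∑-indicator-* a (deg G)) ⟩
  lineEdges G + deg G a                                   ∎
  where
  open ≡-Reasoning
  G′ = addVertex G (just a)
  [b+d]C2 : ∀ b d → (b2n b + d) C 2 ≡ d C 2 + b2n b * d
  [b+d]C2 false d = ≡-sym (+-identityʳ (d C 2))
  [b+d]C2 true  d = trans ([1+n]C2≡n+nC2 d) (trans (+-comm d (d C 2)) (cong (d C 2 +_) (≡-sym (+-identityʳ d))))
  old : ∀ u → deg G′ (suc u) C 2 ≡ deg G u C 2 + indicator a u * deg G u
  old u = trans (cong (_C 2) (deg-addVertex-old G (just a) u)) ([b+d]C2 (does (u ≟ a)) (deg G u))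

module _ (G : Graph) (a : Fin (n G)) where

  deg-addLeaf-at : deg (addVertex G (just a)) (suc a) ≡ suc (deg G a)
  deg-addLeaf-at = trans (deg-addVertex-old G (just a) a) (cong (_+ deg G a) (indicator-self a))

  deg-addLeaf-away : ∀ {u} → u ≢ a → deg (addVertex G (just a)) (suc u) ≡ deg G u
  deg-addLeaf-away {u} u≢a with u ≟ a | deg-addVertex-old G (just a) u
  ... | yes u≡a | _ = contradiction u≡a u≢a
  ... | no _    | e = e

uniqueNeighbour⇒deg≤1 : ∀ G {x} w → (∀ u → Adj G x u → u ≡ w) → deg G x ≤ 1
uniqueNeighbour⇒deg≤1 G {x} w onlyW = begin
  deg G x                           ≡⟨ deg-∑ G x ⟩
  ∑[ u < n G ] b2n (adj G x u)      ≤⟨ ∑-mono-≤ pointwise ⟩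
  ∑[ u < n G ] indicator w u        ≡⟨ ∑-indicator w ⟩
  1                                 ∎
  where
  open ≤-Reasoning
  pointwise : ∀ u → b2n (adj G x u) ≤ indicator w u
  pointwise u with adj G x u in xu
  ... | false = z≤n
  ... | true rewrite onlyW u xu = ≤-reflexive (≡-sym (indicator-self w))

lineEdges-deg≤1 : ∀ G → (∀ v → deg G v ≤ 1) → lineEdges G ≡ 0
lineEdges-deg≤1 G deg≤1 =
  trans (sum-map-allFin (n G) _) (trans (sum-cong-≗ vanish) (sum-replicate-zero (n G)))
  where
  vanish : ∀ v → deg G v C 2 ≡ 0
  vanish v with deg G v | deg≤1 v
  ... | zero     | _ = refl
  ... | suc zero | _ = refl
  ... | suc (suc _) | s≤s ()

-- Cycles

module _ {A : Set} where

  Unique-∷ʳ : ∀ {x : A} {xs} → Unique (x ∷ xs) → Unique (xs ∷ʳ x)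
  Unique-∷ʳ {xs = []}     _                          = [] ∷ []
  Unique-∷ʳ {xs = y ∷ ys} ((x≢y ∷ x∉ys) ∷ (y∉ys ∷ u)) =
    All.++⁺ y∉ys ((λ y≡x → x≢y (≡-sym y≡x)) ∷ []) ∷ Unique-∷ʳ (x∉ys ∷ u)

  Unique-++⁻ˡ : ∀ (xs : List A) {ys} → Unique (xs ++ ys) → Unique xs
  Unique-++⁻ˡ []       _       = []
  Unique-++⁻ˡ (x ∷ xs) (a ∷ u) = All.++⁻ˡ xs a ∷ Unique-++⁻ˡ xs u

  lastOf-∷ʳ : ∀ (x : A) xs y → lastOf x (xs ∷ʳ y) ≡ y
  lastOf-∷ʳ x []       y = refl
  lastOf-∷ʳ x (z ∷ zs) y = lastOf-∷ʳ z zs y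

  lastOf-∈ : ∀ (x : A) xs → lastOf x xs ∈ x ∷ xs
  lastOf-∈ x []       = here refl
  lastOf-∈ x (y ∷ ys) = there (lastOf-∈ y ys)

  lastOf-map : ∀ {B : Set} (f : A → B) x xs → lastOf (f x) (map f xs) ≡ f (lastOf x xs)
  lastOf-map f x []       = refl
  lastOf-map f x (y ∷ ys) = lastOf-map f y ys

module _ (G : Graph) where

  Adj-sym : ∀ {u v} → Adj G u v → Adj G v u
  Adj-sym {u} {v} uv = trans (sym G v u) uv

  Walk-∷ʳ : ∀ x xs {y} → Walk G (x ∷ xs) → Adj G (lastOf x xs) y → Walk G (x ∷ xs ∷ʳ y)
  Walk-∷ʳ x []       w       xy = xy , tt
  Walk-∷ʳ x (z ∷ zs) (xz , w) zy = xz , Walk-∷ʳ z zs w zy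

  Walk-++⁻ˡ : ∀ x xs {ys} → Walk G (x ∷ xs ++ ys) → Walk G (x ∷ xs)
  Walk-++⁻ˡ x []       _        = tt
  Walk-++⁻ˡ x (z ∷ zs) (xz , w) = xz , Walk-++⁻ˡ z zs w

  IsCycle-rotate₁ : ∀ v w ws → IsCycle G (v ∷ w ∷ ws) → IsCycle G (w ∷ ws ∷ʳ v)
  IsCycle-rotate₁ v w ws (3≤ , u , (vw , walk) , close) =
    ≤-trans 3≤ (≤-reflexive (length-++-comm [ v ] (w ∷ ws))) ,
    Unique-∷ʳ u ,
    Walk-∷ʳ w ws walk close ,
    subst (λ z → Adj G z w) (≡-sym (lastOf-∷ʳ w ws v)) vw

  IsCycle-rotate : ∀ pre x post → IsCycle G (pre ++ x ∷ post) → IsCycle G (x ∷ post ++ pre)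
  IsCycle-rotate []            x post c =
    subst (λ c → IsCycle G (x ∷ c)) (≡-sym (++-identityʳ post)) c
  IsCycle-rotate (p ∷ [])      x post c = IsCycle-rotate₁ p x post c
  IsCycle-rotate (p ∷ q ∷ pre) x post c =
    subst (λ c → IsCycle G (x ∷ c)) (++-assoc post [ p ] (q ∷ pre))
      (IsCycle-rotate (q ∷ pre) x (post ∷ʳ p)
        (subst (λ c → IsCycle G (q ∷ c)) (++-assoc pre (x ∷ post) [ p ])
          (IsCycle-rotate₁ p q (pre ++ x ∷ post) c)))

  cycle⇒twoNeighbours : ∀ {x c} → x ∈ c → IsCycle G c →
                        ∃₂ λ y z → y ≢ z × Adj G x y × Adj G x z
  cycle⇒twoNeighbours {x} x∈c cyc with ∈-∃++ x∈c
  ... | pre , post , refl with post ++ pre | IsCycle-rotate pre x post cyc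
  ...   | []        | (s≤s () , _)
  ...   | _ ∷ []    | (s≤s (s≤s ()) , _)
  ...   | w ∷ u ∷ us | (_ , (_ ∷ (w∉ ∷ _)) , (xw , _) , close) =
    w , lastOf u us , (λ w≡ → All-lookup w∉ (lastOf-∈ u us) w≡) , xw , Adj-sym close

module _ (G : Graph) {m} (f : Fin m → Fin (n G)) where

  IsCycle-induced⁻ : ∀ c → IsCycle G (map f c) → IsCycle (induced G f) c
  IsCycle-induced⁻ (v ∷ vs) (3≤ , u , walk , close) =
    subst (3 ≤_) (length-map f (v ∷ vs)) 3≤ ,
    Unique.map⁻ u ,
    walk⁻ (v ∷ vs) walk ,
    subst (λ z → Adj G z (f v)) (lastOf-map f v vs) close
    where
    walk⁻ : ∀ c → Walk G (map f c) → Walk (induced G f) c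
    walk⁻ []           _         = tt
    walk⁻ (x ∷ [])     _         = tt
    walk⁻ (x ∷ y ∷ c)  (xy , w)  = xy , walk⁻ (y ∷ c) w

  IsCycle-induced⁺ : (∀ {x y} → f x ≡ f y → x ≡ y) →
                     ∀ c → IsCycle (induced G f) c → IsCycle G (map f c)
  IsCycle-induced⁺ injective (v ∷ vs) (3≤ , u , walk , close) =
    subst (3 ≤_) (≡-sym (length-map f (v ∷ vs))) 3≤ ,
    Unique.map⁺ injective u ,
    walk⁺ (v ∷ vs) walk ,
    subst (λ z → Adj G z (f v)) (≡-sym (lastOf-map f v vs)) close
    where
    walk⁺ : ∀ c → Walk (induced G f) c → Walk G (map f c)
    walk⁺ []           _         = tt
    walk⁺ (x ∷ [])     _         = tt
    walk⁺ (x ∷ y ∷ c)  (xy , w)  = xy , walk⁺ (y ∷ c) w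

  Acyclic-induced : (∀ {x y} → f x ≡ f y → x ≡ y) → Acyclic G → Acyclic (induced G f)
  Acyclic-induced injective acyclic c cyc = acyclic (map f c) (IsCycle-induced⁺ injective c cyc)

neighbourOf-unique : ∀ {m} (mb : Maybe (Fin m)) {y z} →
                     neighbourOf mb y ≡ true → neighbourOf mb z ≡ true → y ≡ z
neighbourOf-unique (just a) {y} {z} ya za with y ≟ a | z ≟ a
... | yes refl | yes refl = refl

new-vertex-off-cycles : ∀ G mb {c} → zero ∈ c → ¬ IsCycle (addVertex G mb) c
new-vertex-off-cycles G mb 0∈c cyc with cycle⇒twoNeighbours (addVertex G mb) 0∈c cyc
... | zero  , _     , _   , ()  , _
... | suc _ , zero  , _   , _   , ()
... | suc y , suc z , y≢z , 0y , 0z = y≢z (cong suc (neighbourOf-unique mb 0y 0z))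

zero∉⇒map-suc : ∀ {m} (c : List (Fin (suc m))) → zero ∉ c → ∃ λ c₀ → c ≡ map suc c₀
zero∉⇒map-suc []          _   = [] , refl
zero∉⇒map-suc (zero ∷ c)  0∉c = contradiction (here refl) 0∉c
zero∉⇒map-suc (suc x ∷ c) 0∉c with zero∉⇒map-suc c (0∉c ∘ there)
... | c₀ , refl = x ∷ c₀ , refl

Acyclic-addVertex : ∀ G mb → Acyclic G → Acyclic (addVertex G mb)
Acyclic-addVertex G mb acyclic c cyc with any? (zero ≟_) c
... | yes 0∈c = new-vertex-off-cycles G mb 0∈c cyc
... | no 0∉c with zero∉⇒map-suc c 0∉c
...   | c₀ , refl = acyclic c₀ (IsCycle-induced⁻ (addVertex G mb) suc c₀ cyc)

-- Leaves and the forest bound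

module _ (G : Graph) where

  private
    V = Fin (n G)

  _∈?_ : (u : V) (p : List V) → Dec (u ∈ p)
  u ∈? p = any? (u ≟_) p

  offPath : V → List V → ℕ
  offPath u p = b2n (not (does (u ∈? p)))

  unvisited : List V → ℕ
  unvisited p = ∑[ u < n G ] offPath u p

  unvisited-∷ : ∀ {y p} → y ∉ p → unvisited (y ∷ p) < unvisited p
  unvisited-∷ {y} {p} y∉p = ∑-mono-< y (λ u → shrink (does (u ≟ y)) (does (u ∈? p))) fresh
    where
    shrink : ∀ a b → b2n (not (a ∨ b)) ≤ b2n (not b)
    shrink true  b = z≤n
    shrink false b = ≤-refl
    fresh : offPath y (y ∷ p) < offPath y p
    fresh with y ≟ y | any? (y ≟_) p
    ... | yes _   | no _    = s≤s z≤n
    ... | no y≢y  | _       = contradiction refl y≢y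
    ... | yes _   | yes y∈p = contradiction y∈p y∉p

  chord⇒cycle : ∀ {x w y} rest → Unique (x ∷ w ∷ rest) → Walk G (x ∷ w ∷ rest) →
                y ∈ rest → Adj G x y → ¬ Acyclic G
  chord⇒cycle {x} {w} {y} rest unique walk y∈rest xy acyclic with ∈-∃++ y∈rest
  ... | r₁ , r₂ , refl = acyclic (x ∷ w ∷ r₁ ∷ʳ y) (long , prefix-unique , prefix-walk , closing)
    where
    split : x ∷ w ∷ r₁ ++ y ∷ r₂ ≡ (x ∷ w ∷ r₁ ∷ʳ y) ++ r₂
    split = cong (λ c → x ∷ w ∷ c) (≡-sym (++-assoc r₁ (y ∷ []) r₂))
    long : 3 ≤ length (x ∷ w ∷ r₁ ∷ʳ y)
    long = s≤s (s≤s (subst (1 ≤_) (≡-sym (length-++-sucʳ r₁ y [])) (s≤s z≤n)))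
    prefix-unique = Unique-++⁻ˡ (x ∷ w ∷ r₁ ∷ʳ y) (subst Unique split unique)
    prefix-walk   = Walk-++⁻ˡ G x (w ∷ r₁ ∷ʳ y) (subst (Walk G) split walk)
    closing = subst (λ z → Adj G z x) (≡-sym (lastOf-∷ʳ w r₁ y)) (Adj-sym G xy)

  module _ (acyclic : Acyclic G) where

    previous : V → List V → V
    previous x []      = x
    previous x (w ∷ _) = w

    -- A path end whose neighbours all lie on the path is adjacent only to its predecessor,
    -- since any other neighbour would close a cycle.
    dead-end : ∀ x rest → Unique (x ∷ rest) → Walk G (x ∷ rest) →
               (∀ u → Adj G x u → u ∈ x ∷ rest) → ∀ u → Adj G x u → u ≡ previous x rest
    dead-end x rest unique walk onPath u xu with onPath u xu
    dead-end x []         _      _    _ u xu | here u≡x = u≡x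
    dead-end x (w ∷ rest) unique walk _ u xu | here refl = contradiction (trans (≡-sym (irrefl G x)) xu) λ ()
    dead-end x (w ∷ rest) unique walk _ u xu | there (here u≡w) = u≡w
    dead-end x (w ∷ rest) unique walk _ u xu | there (there u∈rest) =
      contradiction acyclic (chord⇒cycle rest unique walk u∈rest xu)

    leafAlongPath : ∀ budget x rest → unvisited (x ∷ rest) ≤ budget → Unique (x ∷ rest) → Walk G (x ∷ rest) →
               ∃ λ v → deg G v ≤ 1
    leafAlongPath budget x rest bound unique walk
      with Fin.any? (λ y → (adj G x y Bool.≟ true) ×-dec ¬? (y ∈? (x ∷ rest)))
    ... | no noFresh = x , uniqueNeighbour⇒deg≤1 G (previous x rest) (dead-end x rest unique walk onPath)
      where
      onPath : ∀ u → Adj G x u → u ∈ x ∷ rest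
      onPath u xu with u ∈? (x ∷ rest)
      ... | yes u∈ = u∈
      ... | no u∉  = contradiction (u , xu , u∉) noFresh
    leafAlongPath zero    x rest bound unique walk | yes (y , _ , y∉) =
      contradiction (≤-trans (unvisited-∷ y∉) bound) λ ()
    leafAlongPath (suc b) x rest bound unique walk | yes (y , xy , y∉) =
      leafAlongPath b y (x ∷ rest) (≤-pred (≤-trans (unvisited-∷ y∉) bound))
        (¬Any⇒All¬ _ y∉ ∷ unique) (Adj-sym G xy , walk)

    acyclic⇒leaf : V → ∃ λ v → deg G v ≤ 1
    acyclic⇒leaf x = leafAlongPath (unvisited (x ∷ [])) x [] ≤-refl ([] ∷ []) tt

-- Removing a leaf lowers the degree sum by at most 2.  The size m is an explicit index so that,
-- once n G ≡ 2 + k is matched, the leaf can be removed with punchIn.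
degreeSum-acyclic′ : ∀ m G → n G ≡ m → Acyclic G → degreeSum G ≤ 2 * (m ∸ 1)
degreeSum-acyclic′ zero          G refl _ = z≤n
degreeSum-acyclic′ (suc zero)    G refl _ = ≤-reflexive (cong (λ b → b2n b + 0 + 0) (irrefl G zero))
degreeSum-acyclic′ (suc (suc k)) G refl acyclic =
  let v , deg≤1 = acyclic⇒leaf G acyclic zero
      H = induced G (punchIn v)
  in begin
  degreeSum G                       ≡⟨ degreeSum-induced G v (punchIn v) (λ g → sum-remove g) ⟩
  deg G v + deg G v + degreeSum H   ≤⟨ +-mono-≤ (+-mono-≤ deg≤1 deg≤1) (degreeSum-acyclic′ (suc k) H refl
                                         (Acyclic-induced G (punchIn v) (punchIn-injective v _ _) acyclic)) ⟩
  1 + 1 + 2 * k                     ≡⟨ *-distribˡ-+ 2 1 k ⟨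
  2 * suc k                         ∎
  where open ≤-Reasoning

degreeSum-acyclic : ∀ G → Acyclic G → degreeSum G ≤ 2 * (n G ∸ 1)
degreeSum-acyclic G = degreeSum-acyclic′ (n G) G refl

-- The upper bound

module _ {N D q k} (N∸1≡ : N ∸ 1 ≡ q * D + k) (k<D : k < D) {F : Graph} where

  private
    m = n F
    excess : Fin m → ℕ
    excess v = deg F v ∸ 1

  lineEdges-≤ : Admissible N (suc D) F → lineEdges F ≤ extremalValue D q k
  lineEdges-≤ (acyclic , edges≡N , (deg≤ , v , _) , deg≥1) = *-cancelˡ-≤ 2 (begin
    2 * lineEdges F                     ≡⟨ cong (2 *_) (sum-map-allFin m _) ⟩
    2 * ∑[ v < m ] (deg F v C 2)        ≡⟨ *-distribˡ-sum 2 (λ v → deg F v C 2) ⟩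
    ∑[ v < m ] (2 * (deg F v C 2))      ≡⟨ sum-cong-≗ doubled ⟩
    ∑[ v < m ] pronic (excess v)        ≡⟨ sum-tabulate (pronic ∘ excess) ⟨
    sum (tabulate (pronic ∘ excess))    ≡⟨ cong sum (map-tabulate excess pronic) ⟨
    sum (map pronic (tabulate excess))  ≤⟨ extremalValue-maximal q k (tabulate excess) (tabulate⁺ excess≤D) k<D excess-sum ⟩
    2 * extremalValue D q k             ∎)
    where
    open ≤-Reasoning
    doubled : ∀ v → 2 * (deg F v C 2) ≡ pronic (excess v)
    doubled v with deg F v | deg≥1 v
    ... | suc d | _ = 2*[1+n]C2≡pronic d
    excess≤D : ∀ v → excess v ≤ D
    excess≤D v = ∸-monoˡ-≤ 1 (deg≤ v)
    excess+m : ∑[ v < m ] excess v + m ≡ 2 * N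
    excess+m = begin-equality
      ∑[ v < m ] excess v + m                 ≡⟨ cong (∑[ v < m ] excess v +_) (trans (∑-const m 1) (*-identityʳ m)) ⟨
      ∑[ v < m ] excess v + ∑[ v < m ] 1      ≡⟨ ∑-distrib-+ excess (λ _ → 1) ⟨
      ∑[ v < m ] (excess v + 1)               ≡⟨ sum-cong-≗ (λ v → m∸n+n≡m (deg≥1 v)) ⟩
      degreeSum F                             ≡⟨ handshake F ⟩
      2 * edges F                             ≡⟨ cong (2 *_) edges≡N ⟩
      2 * N                                   ∎
    N<m : N + 1 ≤ m
    N<m = begin
      N + 1          ≤⟨ +-monoˡ-≤ 1 (*-cancelˡ-≤ 2 2N≤) ⟩
      m ∸ 1 + 1      ≡⟨ m∸n+n≡m (≤-trans (s≤s z≤n) (toℕ<n v)) ⟩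
      m              ∎
      where
      2N≤ : 2 * N ≤ 2 * (m ∸ 1)
      2N≤ = subst (_≤ 2 * (m ∸ 1)) (trans (handshake F) (cong (2 *_) edges≡N)) (degreeSum-acyclic F acyclic)
    excess-sum : sum (tabulate excess) ≤ q * D + k
    excess-sum = begin
      sum (tabulate excess)  ≡⟨ sum-tabulate excess ⟩
      s                      ≤⟨ m+n≤o⇒m≤o∸n s (+-cancelʳ-≤ N (s + 1) N (begin
        s + 1 + N              ≡⟨ trans (+-assoc s 1 N) (cong (s +_) (+-comm 1 N)) ⟩
        s + (N + 1)            ≤⟨ +-monoʳ-≤ s N<m ⟩
        s + m                  ≡⟨ excess+m ⟩
        2 * N                  ≡⟨ cong (N +_) (+-identityʳ N) ⟩
        N + N                  ∎)) ⟩
      N ∸ 1                  ≡⟨ N∸1≡ ⟩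
      q * D + k              ∎
      where s = ∑[ v < m ] excess v

-- Extremal forests

-- A forest under construction with a distinguished vertex, the tip, to which leaves are
-- attached: E edges, tip degree d, and L counts the line edges at vertices other than the tip.
record Caterpillar (Δ E L d : ℕ) : Set where
  field
    graph      : Graph
    tip        : Fin (n graph)
    acyclic    : Acyclic graph
    edges≡     : edges graph ≡ E
    lineEdges≡ : lineEdges graph ≡ L + d C 2
    tip-deg    : deg graph tip ≡ d
    deg≥1      : MinDegPos graph
    deg≤Δ      : ∀ v → deg graph v ≤ Δ
open Caterpillar

OffTip : ∀ {Δ E L d} → Caterpillar Δ E L d → ℕ → Set
OffTip T d′ = ∃ λ v → v ≢ tip T × deg (graph T) v ≡ d′

attachLeaf : ∀ {Δ E L d} → Caterpillar Δ E L d → d < Δ → Caterpillar Δ (suc E) L (suc d)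
attachLeaf {Δ} {E} {L} {d} T d<Δ = record
  { graph      = G′
  ; tip        = suc a
  ; acyclic    = Acyclic-addVertex G (just a) (acyclic T)
  ; edges≡     = trans (edges-addVertex G (just a)) (cong suc (edges≡ T))
  ; lineEdges≡ = begin
      lineEdges G′          ≡⟨ lineEdges-addLeaf G a ⟩
      lineEdges G + deg G a ≡⟨ cong₂ _+_ (lineEdges≡ T) (tip-deg T) ⟩
      L + d C 2 + d         ≡⟨ +-assoc L (d C 2) d ⟩
      L + (d C 2 + d)       ≡⟨ cong (L +_) (trans (+-comm (d C 2) d) (≡-sym ([1+n]C2≡n+nC2 d))) ⟩
      L + suc d C 2         ∎
  ; tip-deg    = trans (deg-addLeaf-at G a) (cong suc (tip-deg T))
  ; deg≥1      = deg≥1′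
  ; deg≤Δ      = deg≤Δ′
  }
  where
  open ≡-Reasoning
  G = graph T
  a = tip T
  G′ = addVertex G (just a)
  deg≥1′ : MinDegPos G′
  deg≥1′ zero    = ≤-reflexive (≡-sym (deg-addVertex-new G (just a)))
  deg≥1′ (suc u) =
    ≤-trans (deg≥1 T u) (≤-trans (m≤n+m (deg G u) _) (≤-reflexive (≡-sym (deg-addVertex-old G (just a) u))))
  deg≤Δ′ : ∀ v → deg G′ v ≤ Δ
  deg≤Δ′ zero = ≤-trans (≤-reflexive (deg-addVertex-new G (just a))) (≤-trans (s≤s z≤n) d<Δ)
  deg≤Δ′ (suc u) = at-or-away (u ≟ a)
    where
    at-or-away : Dec (u ≡ a) → deg G′ (suc u) ≤ Δ
    at-or-away (yes refl) = ≤-trans (≤-reflexive (trans (deg-addLeaf-at G a) (cong suc (tip-deg T)))) d<Δ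
    at-or-away (no u≢a)   = ≤-trans (≤-reflexive (deg-addLeaf-away G a u≢a)) (deg≤Δ T u)

module _ {Δ E L d : ℕ} where

  reindex : ∀ {E′ L′} → E ≡ E′ → L ≡ L′ → Caterpillar Δ E L d → Caterpillar Δ E′ L′ d
  reindex E≡ L≡ T = record
    { graph = graph T ; tip = tip T ; acyclic = acyclic T
    ; edges≡     = trans (edges≡ T) E≡
    ; lineEdges≡ = trans (lineEdges≡ T) (cong (_+ d C 2) L≡)
    ; tip-deg = tip-deg T ; deg≥1 = deg≥1 T ; deg≤Δ = deg≤Δ T
    }

  attachLeaf-keeps : ∀ {d′} (T : Caterpillar Δ E L d) (d<Δ : d < Δ) →
                     OffTip T d′ → OffTip (attachLeaf T d<Δ) d′
  attachLeaf-keeps T d<Δ (v , v≢tip , deg-v) =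
    suc v , (λ sv≡ → v≢tip (Fin.suc-injective sv≡)) , trans (deg-addLeaf-away (graph T) (tip T) v≢tip) deg-v

  attachLeaf-fresh : (T : Caterpillar Δ E L d) (d<Δ : d < Δ) → OffTip (attachLeaf T d<Δ) 1
  attachLeaf-fresh T d<Δ = zero , (λ ()) , deg-addVertex-new (graph T) (just (tip T))

  -- Moving the tip to a leaf freezes the old tip's contribution d C 2 into L.
  retip : (T : Caterpillar Δ E L d) → OffTip T 1 → Caterpillar Δ E (L + d C 2) 1
  retip T (w , _ , deg-w) = record
    { graph = graph T ; tip = w ; acyclic = acyclic T ; edges≡ = edges≡ T
    ; lineEdges≡ = trans (lineEdges≡ T) (≡-sym (+-identityʳ _))
    ; tip-deg    = deg-w
    ; deg≥1 = deg≥1 T ; deg≤Δ = deg≤Δ T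
    }

  retip-keeps : (T : Caterpillar Δ E L d) (leaf : OffTip T 1) → OffTip (retip T leaf) d
  retip-keeps T (w , w≢tip , _) = tip T , (λ tip≡w → w≢tip (≡-sym tip≡w)) , tip-deg T

attachLeaves : ∀ {Δ E L d} j → Caterpillar Δ E L d → j + d ≤ Δ → Caterpillar Δ (j + E) L (j + d)
attachLeaves zero    T _       = T
attachLeaves (suc j) T j+d<Δ = attachLeaf (attachLeaves j T (<⇒≤ j+d<Δ)) j+d<Δ

attachLeaves-keeps : ∀ {Δ E L d d′} j (T : Caterpillar Δ E L d) (j+d≤Δ : j + d ≤ Δ) →
                     OffTip T d′ → OffTip (attachLeaves j T j+d≤Δ) d′
attachLeaves-keeps zero    T _     other = other
attachLeaves-keeps (suc j) T j+d<Δ other =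
  attachLeaf-keeps (attachLeaves j T (<⇒≤ j+d<Δ)) j+d<Δ (attachLeaves-keeps j T (<⇒≤ j+d<Δ) other)

K₀ : Graph
K₀ = record { n = 0 ; adj = λ () ; sym = λ () ; irrefl = λ () }

Acyclic-K₀ : Acyclic K₀
Acyclic-K₀ []      ()
Acyclic-K₀ (() ∷ _) _

K₂ : ∀ {Δ} → 1 ≤ Δ → Caterpillar Δ 1 0 1
K₂ {Δ} 1≤Δ = record
  { graph      = G
  ; tip        = suc zero
  ; acyclic    = Acyclic-addVertex _ (just zero) (Acyclic-addVertex K₀ nothing Acyclic-K₀)
  ; edges≡     = refl
  ; lineEdges≡ = refl
  ; tip-deg    = refl
  ; deg≥1      = deg≥1′
  ; deg≤Δ      = deg≤Δ′
  }
  where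
  G = addVertex (addVertex K₀ nothing) (just zero)
  deg≥1′ : MinDegPos G
  deg≥1′ zero       = s≤s z≤n
  deg≥1′ (suc zero) = s≤s z≤n
  deg≤Δ′ : ∀ v → deg G v ≤ Δ
  deg≤Δ′ zero       = 1≤Δ
  deg≤Δ′ (suc zero) = 1≤Δ

-- Turns the tip (a leaf) into a vertex of full degree D + 1 and moves the tip to a new leaf.
grow : ∀ {D E L} → 1 ≤ D → Caterpillar (suc D) E L 1 →
       Σ (Caterpillar (suc D) (D + E) (L + suc D C 2) 1) λ T → OffTip T (suc D)
grow {suc j} {E} {L} _ T =
  reindex refl (cong (λ x → L + x C 2) j+2≡) (retip T₁ leaf) ,
  map₂ (map₂ (λ deg-v → trans deg-v j+2≡)) (retip-keeps T₁ leaf)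
  where
  j+2≡ = +-comm (suc j) 1
  full : suc j + 1 ≤ suc (suc j)
  full = ≤-reflexive j+2≡
  T₁ = attachLeaves (suc j) T full
  leaf = attachLeaf-fresh (attachLeaves j T (<⇒≤ full)) full

spine : ∀ {D} → 1 ≤ D → ∀ q → Caterpillar (suc D) (q * D + 1) (q * (suc D C 2)) 1
spine         1≤D zero    = K₂ (s≤s z≤n)
spine {D} 1≤D (suc q) =
  reindex (≡-sym (+-assoc D (q * D) 1)) (+-comm (q * (suc D C 2)) (suc D C 2)) (proj₁ (grow 1≤D (spine 1≤D q)))

-- q + 1 vertices of degree D + 1 along a path, ending in a vertex of degree k + 1.
extremalCaterpillar : ∀ {N D q k} → k < D → 1 ≤ N → N ∸ 1 ≡ suc q * D + k →
                      Σ Graph λ F → Admissible N (suc D) F × lineEdges F ≡ extremalValue D (suc q) k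
extremalCaterpillar {N} {D} {q} {k} k<D 1≤N N∸1≡ =
  graph T , (acyclic T , edges-T , (deg≤Δ T , v , deg-v) , deg≥1 T) , lineEdges-T
  where
  open ≡-Reasoning
  1≤D = ≤-trans (s≤s z≤n) k<D
  grown = grow 1≤D (spine 1≤D q)
  k+1≤ : k + 1 ≤ suc D
  k+1≤ = ≤-trans (≤-reflexive (+-comm k 1)) (s≤s (<⇒≤ k<D))
  T = attachLeaves k (proj₁ grown) k+1≤
  hub = attachLeaves-keeps k (proj₁ grown) k+1≤ (proj₂ grown)
  v = proj₁ hub
  deg-v = proj₂ (proj₂ hub)
  edges-T : edges (graph T) ≡ N
  edges-T = begin
    edges (graph T)             ≡⟨ edges≡ T ⟩
    k + (D + (q * D + 1))       ≡⟨ identity k D (q * D) ⟩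
    suc q * D + k + 1           ≡⟨ cong (_+ 1) N∸1≡ ⟨
    N ∸ 1 + 1                   ≡⟨ m∸n+n≡m 1≤N ⟩
    N                           ∎
    where
    identity : ∀ k D e → k + (D + (e + 1)) ≡ D + e + k + 1
    identity = solve-∀
  lineEdges-T : lineEdges (graph T) ≡ extremalValue D (suc q) k
  lineEdges-T = begin
    lineEdges (graph T)                             ≡⟨ lineEdges≡ T ⟩
    q * (suc D C 2) + suc D C 2 + (k + 1) C 2       ≡⟨ cong₂ (λ a b → a + b C 2) (+-comm (q * (suc D C 2)) (suc D C 2)) (+-comm k 1) ⟩
    suc q * (suc D C 2) + suc k C 2                 ∎

matching : ℕ → Graph
matching zero    = K₀
matching (suc N) = addVertex (addVertex (matching N) nothing) (just zero)

Acyclic-matching : ∀ N → Acyclic (matching N)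
Acyclic-matching zero    = Acyclic-K₀
Acyclic-matching (suc N) =
  Acyclic-addVertex (addVertex (matching N) nothing) (just zero) (Acyclic-addVertex _ nothing (Acyclic-matching N))

edges-matching : ∀ N → edges (matching N) ≡ N
edges-matching zero    = refl
edges-matching (suc N) = trans (edges-addVertex (addVertex (matching N) nothing) (just zero))
                           (cong suc (trans (edges-addVertex (matching N) nothing) (edges-matching N)))

deg-matching : ∀ N v → deg (matching N) v ≡ 1
deg-matching (suc N) zero          = deg-addVertex-new (addVertex (matching N) nothing) (just zero)
deg-matching (suc N) (suc zero)    =
  trans (deg-addLeaf-at (addVertex (matching N) nothing) zero) (cong suc (deg-addVertex-new (matching N) nothing))
deg-matching (suc N) (suc (suc u)) =
  trans (deg-addLeaf-away (addVertex (matching N) nothing) zero {suc u} (λ ()))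
        (trans (deg-addVertex-old (matching N) nothing u) (deg-matching N u))

-- The values of g

isG-maxDegree1 : ∀ N → 1 ≤ N → IsG N 1 0
isG-maxDegree1 (suc N) _ =
  (matching (suc N) ,
    (Acyclic-matching (suc N) , edges-matching (suc N) ,
      (deg≤1 , zero , deg-matching (suc N) zero) , λ v → ≤-reflexive (≡-sym (deg-matching (suc N) v))) ,
    lineEdges-deg≤1 (matching (suc N)) deg≤1) ,
  λ F (_ , _ , (deg≤1′ , _) , _) → ≤-reflexive (lineEdges-deg≤1 F deg≤1′)
  where
  deg≤1 : ∀ v → deg (matching (suc N)) v ≤ 1
  deg≤1 v = ≤-reflexive (deg-matching (suc N) v)

isG-extremalValue : ∀ {N D} q k → k < D → suc D ≤ N → N ∸ 1 ≡ q * D + k →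
                    IsG N (suc D) (extremalValue D q k)
isG-extremalValue {N} {D} zero k k<D D<N N∸1≡ = contradiction D≤k (<⇒≱ k<D)
  where
  D≤k : D ≤ k
  D≤k = ≤-trans (m+n≤o⇒m≤o∸n D (≤-trans (≤-reflexive (+-comm D 1)) D<N)) (≤-reflexive N∸1≡)
isG-extremalValue {N} {D} (suc q) k k<D D<N N∸1≡ =
  extremalCaterpillar {q = q} k<D (≤-trans (s≤s z≤n) D<N) N∸1≡ , λ F → lineEdges-≤ {q = suc q} N∸1≡ k<D

isG-closedForm : (N Δ k q : ℕ) → 2 ≤ Δ → Δ ≤ N → k + 2 ≤ Δ → N ∸ 1 ≡ q * (Δ ∸ 1) + k →
                 Σ ℕ λ m → IsG N Δ m × m ≡ ((N ∸ k ∸ 1) * Δ) / 2 + (suc k C 2) × 2 * m ≤ (N ∸ 1) * Δ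
isG-closedForm N (suc D) k q _ Δ≤N k+2≤Δ N∸1≡ =
  extremalValue D q k ,
  isG-extremalValue q k k<D Δ≤N N∸1≡ ,
  extremalValue-closedForm N q k N∸1≡ ,
  subst (2 * extremalValue D q k ≤_) (cong (_* suc D) (≡-sym N∸1≡)) (2*extremalValue≤ q k k<D)
  where
  k<D : k < D
  k<D = ≤-pred (subst (_≤ suc D) (+-comm k 2) k+2≤Δ)

isG-increasing-edges : (N Δ : ℕ) → 2 ≤ Δ → Δ ≤ N →
                       Σ ℕ λ a → Σ ℕ λ b → IsG (suc N) Δ a × IsG N Δ b × b + 1 ≤ a
isG-increasing-edges N (suc D) (s≤s 1≤D) Δ≤N
  with euclideanDivision (N ∸ 1) D 1≤D | euclideanDivision N D 1≤D
... | q , k , N∸1≡ , k<D | q′ , k′ , N≡ , k′<D =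
  extremalValue D q′ k′ , extremalValue D q k ,
  isG-extremalValue q′ k′ k′<D (≤-trans Δ≤N (n≤1+n N)) N≡ , isG-extremalValue q k k<D Δ≤N N∸1≡ ,
  extremalValue-+1 {D = D} q k q′ k′ (1 ∷ k ∷ replicate q D) (1≤D ∷ <⇒≤ k<D ∷ replicate⁺ q ≤-refl) k′<D (≤-reflexive sum≡) beats
  where
  open ≡-Reasoning
  sum≡ : 1 + (k + sum (replicate q D)) ≡ q′ * D + k′
  sum≡ = begin
    1 + (k + sum (replicate q D))  ≡⟨ cong (λ s → 1 + (k + s)) (sum-replicate q D) ⟩
    1 + (k + q * D)                ≡⟨ cong suc (trans (+-comm k (q * D)) (≡-sym N∸1≡)) ⟩
    1 + (N ∸ 1)                    ≡⟨ trans (+-comm 1 (N ∸ 1)) (m∸n+n≡m (≤-trans (s≤s z≤n) Δ≤N)) ⟩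
    N                              ≡⟨ N≡ ⟩
    q′ * D + k′                    ∎
  beats : 2 * extremalValue D q k + 2 ≤ sum (map pronic (1 ∷ k ∷ replicate q D))
  beats = ≤-reflexive (begin
    2 * extremalValue D q k + 2                      ≡⟨ cong (_+ 2) (2*extremalValue D q k) ⟩
    q * pronic D + pronic k + 2                      ≡⟨ identity (q * pronic D) (pronic k) ⟩
    2 + (pronic k + q * pronic D)                    ≡⟨ cong (λ s → 2 + (pronic k + s)) (pronicSum-replicate q D) ⟨
    sum (map pronic (1 ∷ k ∷ replicate q D))         ∎)
    where
    identity : ∀ a b → a + b + 2 ≡ 2 + (b + a)
    identity = solve-∀

isG-increasing-maxDegree : (N Δ : ℕ) → 1 ≤ Δ → Δ < N →
                           Σ ℕ λ a → Σ ℕ λ b → IsG N (suc Δ) a × IsG N Δ b × b + 1 ≤ a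
isG-increasing-maxDegree N 1 _ 1<N with euclideanDivision (N ∸ 1) 1 ≤-refl
... | q , k , N∸1≡ , k<1 =
  extremalValue 1 q k , 0 , isG-extremalValue q k k<1 1<N N∸1≡ , isG-maxDegree1 N (<⇒≤ 1<N) ,
  *-cancelˡ-≤ 2 (extremalValue-maximal q k (1 ∷ []) (≤-refl ∷ []) k<1 (subst (1 ≤_) N∸1≡ 1≤N∸1))
  where
  1≤N∸1 : 1 ≤ N ∸ 1
  1≤N∸1 = m+n≤o⇒m≤o∸n 1 1<N
isG-increasing-maxDegree N (suc (suc D₀)) _ Δ<N
  with euclideanDivision (N ∸ 1) (suc D₀) (s≤s z≤n) | euclideanDivision (N ∸ 1) (suc (suc D₀)) (s≤s z≤n)
... | q , k , N∸1≡ , k<D | q′ , k′ , N∸1≡′ , k′<D+1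
  with transferWitness {q = q} k<D (subst (2 + D₀ ≤_) N∸1≡ Δ≤N∸1)
  where
  Δ≤N∸1 : 2 + D₀ ≤ N ∸ 1
  Δ≤N∸1 = m+n≤o⇒m≤o∸n (2 + D₀) (≤-trans (≤-reflexive (+-comm (2 + D₀) 1)) Δ<N)
...   | ys , ys≤ , sum-ys , beats =
  extremalValue (2 + D₀) q′ k′ , extremalValue (suc D₀) q k ,
  isG-extremalValue q′ k′ k′<D+1 Δ<N N∸1≡′ , isG-extremalValue q k k<D (<⇒≤ Δ<N) N∸1≡ ,
  extremalValue-+1 {D = suc D₀} q k q′ k′ ys ys≤ k′<D+1 (≤-reflexive (trans sum-ys (trans (≡-sym N∸1≡) N∸1≡′)))
    (subst (λ x → x + 2 ≤ sum (map pronic ys)) (≡-sym (2*extremalValue (suc D₀) q k)) beats)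

mainTheorem7 : ((N : ℕ) → 1 ≤ N → IsG N 1 0)
    × ((N Δ k q : ℕ) → 2 ≤ Δ → Δ ≤ N → k + 2 ≤ Δ → N ∸ 1 ≡ q * (Δ ∸ 1) + k →
    Σ ℕ λ m → IsG N Δ m
    × m ≡ ((N ∸ k ∸ 1) * Δ) / 2 + (suc k C 2)
    × 2 * m ≤ (N ∸ 1) * Δ)
    × ((N Δ : ℕ) → 2 ≤ Δ → Δ ≤ N →
    Σ ℕ λ a → Σ ℕ λ b → IsG (suc N) Δ a × IsG N Δ b × b + 1 ≤ a)
    × ((N Δ : ℕ) → 1 ≤ Δ → Δ < N →
    Σ ℕ λ a → Σ ℕ λ b → IsG N (suc Δ) a × IsG N Δ b × b + 1 ≤ a)
mainTheorem7 = isG-maxDegree1 , isG-closedForm , isG-increasing-edges , isG-increasing-maxDegree
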